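{- Let $\sigma$ be an $r$-signotope on $[n]$ and let $F$ be a fliple of $\sigma$. Then $F_{\mathrm{rot}}$ is a fliple of the clockwise rotated signotope $\sigma_{\mathrm{rot}}$.
   Context: For $r\ge 1$, an $r$-signotope on $[n]$ is a map $\sigma:\binom{[n]}{r}\to\{+,-\}$ such that for every $(r+1)$-subset $X=\{x_1<\dots<x_{r+1}\}$ the sequence $\sigma(X_1),\dots,\sigma(X_{r+1})$ has at most one sign change, where $X_j=X\setminus\{x_j\}$. An $r$-subset $F$ is a fliple of $\sigma$ if both assignments $+$ and $-$ to $\sigma(F)$ (keeping all other values) yield an $r$-signotope. The clockwise rotation $\sigma_{\mathrm{rot}}$ is defined on $r$-subsets $x_1<\dots<x_r$ by $\sigma_{\mathrm{rot}}(x_1,\dots,x_r)=-\sigma(1,x_1+1,\dots,x_{r-1}+1)$ if $x_r=n$, and $\sigma_{\mathrm{rot}}(x_1,\dots,x_r)=\sigma(x_1+1,\dots,x_r+1)$ if $x_r<n$. For $x\in[n]$ let $x_{\mathrm{rot}}=x-1$ if $x\ne 1$ and $1_{\mathrm{rot}}=n$; for $X\subseteq[n]$ let $X_{\mathrm{rot}}=\{x_{\mathrm{rot}}:x\in X\}$. -}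

module Defs where

open import Data.Nat using (ℕ; zero; suc; _≤_; _+_)
open import Data.Fin using (Fin; zero; suc; fromℕ; inject₁)
open import Data.Fin.Subset using (Subset; ∣_∣; _-_; inside; outside)
open import Data.Fin.Subset.Properties using (_∈?_)
open import Data.Bool using (Bool; true; false; if_then_else_)
import Data.Bool.Properties as BoolP
open import Data.Vec using (Vec; lookup; tabulate)
open import Data.Vec.Properties using (≡-dec)
open import Data.List using (List; []; _∷_; map; filter)
open import Data.List.Base using (allFin)
open import Data.Sign using (Sign; opposite)
import Data.Sign.Properties as SignP
open import Data.Product using (_×_)
open import Relation.Nullary using (yes; no)
open import Relation.Nullary.Decidable using (⌊_⌋)
open import Relation.Binary.PropositionalEquality using (_≡_)

-- Ground set [n] is represented by Fin n (element k+1 of [n] is the Fin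
-- index k).
-- A map  σ : binom([n], r) → {+,-}  is represented as a function on all
-- subsets, of which only the values on r-subsets are ever consulted.

SignMap : ℕ → Set
SignMap n = Subset n → Sign

signChanges : List Sign → ℕ
signChanges []       = 0
signChanges (a ∷ xs) = go a xs
  where
  go : Sign → List Sign → ℕ
  go _ []       = 0
  go a (b ∷ ys) = (if ⌊ a SignP.≟ b ⌋ then 0 else 1) + go b ys

elements : ∀ {n} → Subset n → List (Fin n)
elements X = filter (λ i → i ∈? X) (allFin _)

deletionSequence : ∀ {n} → SignMap n → Subset n → List Sign
deletionSequence σ X = map (λ x → σ (X - x)) (elements X)

IsSignotope : (r : ℕ) {n : ℕ} → SignMap n → Set
IsSignotope r σ = ∀ X → ∣ X ∣ ≡ suc r → signChanges (deletionSequence σ X) ≤ 1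

setAt : ∀ {n} → SignMap n → Subset n → Sign → SignMap n
setAt σ F s X with ≡-dec BoolP._≟_ X F
... | yes _ = s
... | no  _ = σ X

IsFliple : (r : ℕ) {n : ℕ} → SignMap n → Subset n → Set
IsFliple r σ F =
  (∣ F ∣ ≡ r) × (IsSignotope r (setAt σ F Sign.+) × IsSignotope r (setAt σ F Sign.-))

-- x ↦ x_rot :  x ↦ x - 1 for x ≠ 1, and 1 ↦ n   (0-indexed: 0 ↦ n-1)
rotElem : ∀ {n} → Fin n → Fin n
rotElem {suc m} zero    = fromℕ m
rotElem {suc m} (suc i) = inject₁ i

-- inverse map y ↦ y + 1 for y ≠ n, and n ↦ 1
unrotElem : ∀ {n} → Fin n → Fin n
unrotElem {suc zero}    zero    = zero
unrotElem {suc (suc m)} zero    = suc zero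
unrotElem {suc (suc m)} (suc i) with unrotElem {suc m} i
... | zero  = zero
... | suc j = suc (suc j)

-- X_rot = { x_rot : x ∈ X },  i.e.  y ∈ X_rot  iff  unrot y ∈ X
rotSet : ∀ {n} → Subset n → Subset n
rotSet X = tabulate (λ y → lookup X (unrotElem y))

containsMax : ∀ {n} → Subset n → Bool
containsMax {zero}  X = false
containsMax {suc m} X = lookup X (fromℕ m)

-- the set {1, x₁+1, …, x_{r-1}+1} if x_r = n, resp. {x₁+1, …, x_r+1}
-- if x_r < n; i.e. { y : y_rot ∈ X }
shiftSet : ∀ {n} → Subset n → Subset n
shiftSet X = tabulate (λ y → lookup X (rotElem y))

rotSig : ∀ {n} → SignMap n → SignMap n
rotSig σ X = if containsMax X then opposite (σ (shiftSet X)) else σ (shiftSet X)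

{-# OPTIONS --safe #-}
module Submission where

-- Write an (r+1)-set X as Y ∷ʳ b, b recording whether n ∈ X.  If n ∉ X,
-- the deletion sequence of σ_rot on X is that of σ on the shifted set
-- false ∷ Y.  If n ∈ X, it is that of σ on true ∷ Y with its first entry
-- moved to the end and all other entries negated, and this cyclic move
-- preserves "at most one sign change".  So rotation maps signotopes to
-- signotopes.  Moreover, rotating σ with its value at F set to t gives
-- σ_rot with its value at F_rot set to t, negated when n ∈ F_rot; as t
-- ranges over both signs so does the new value, and F_rot is a fliple.

open import Defs
open import Data.Nat using (ℕ; zero; suc; _≤_; z≤n; s≤s)
open import Data.Nat.Properties using (m≤n⇒m≤1+n)
open import Data.Fin using (Fin; zero; suc; fromℕ; inject₁)
open import Data.Fin.Subset using (Subset; ∣_∣)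
import Data.Fin.Subset as Subset
open import Data.Fin.Subset.Properties using (_∈?_; p─⊥≡p)
open import Data.Bool using (Bool; true; false; if_then_else_)
import Data.Bool.Properties as BoolP
open import Data.Vec using (Vec; []; _∷_; _∷ʳ_; lookup; initLast)
open import Data.Vec.Properties using (≡-dec; tabulate-cong; tabulate∘lookup)
open import Data.List using (List; []; _∷_; map; filter; _++_; [_]; allFin)
import Data.List as List
open import Data.List.Properties using (map-cong; map-tabulate; map-∘; map-++)
open import Data.Sign using (Sign; opposite; +; -)
open import Data.Sign.Properties using (opposite-involutive)
open import Data.Product using (_,_)
open import Data.Empty using (⊥-elim)
open import Function using (id; _∘_)
open import Relation.Nullary using (yes; no; does)
open import Relation.Binary.PropositionalEquality
  using (_≡_; _≢_; _≗_; refl; sym; trans; cong; cong₂; subst; module ≡-Reasoning)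

signChanges-map-opposite : ∀ L → signChanges (map opposite L) ≡ signChanges L
signChanges-map-opposite []          = refl
signChanges-map-opposite (_ ∷ [])    = refl
signChanges-map-opposite (+ ∷ + ∷ L) = signChanges-map-opposite (+ ∷ L)
signChanges-map-opposite (+ ∷ - ∷ L) = cong suc (signChanges-map-opposite (- ∷ L))
signChanges-map-opposite (- ∷ + ∷ L) = cong suc (signChanges-map-opposite (+ ∷ L))
signChanges-map-opposite (- ∷ - ∷ L) = signChanges-map-opposite (- ∷ L)

signChanges-snoc-head : ∀ s L → signChanges (s ∷ L) ≤ 0 → signChanges (s ∷ L ++ [ s ]) ≤ 0
signChanges-snoc-head + []      _ = z≤n
signChanges-snoc-head - []      _ = z≤n
signChanges-snoc-head + (+ ∷ L) p = signChanges-snoc-head + L p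
signChanges-snoc-head - (- ∷ L) p = signChanges-snoc-head - L p
signChanges-snoc-head + (- ∷ L) ()
signChanges-snoc-head - (+ ∷ L) ()

signChanges-snoc-opposite-head : ∀ s L → signChanges (s ∷ L) ≤ 1 →
                                 signChanges (s ∷ L ++ [ opposite s ]) ≤ 1
signChanges-snoc-opposite-head + []      _       = s≤s z≤n
signChanges-snoc-opposite-head - []      _       = s≤s z≤n
signChanges-snoc-opposite-head + (+ ∷ L) p       = signChanges-snoc-opposite-head + L p
signChanges-snoc-opposite-head - (- ∷ L) p       = signChanges-snoc-opposite-head - L p
signChanges-snoc-opposite-head + (- ∷ L) (s≤s p) = s≤s (signChanges-snoc-head - L p)
signChanges-snoc-opposite-head - (+ ∷ L) (s≤s p) = s≤s (signChanges-snoc-head + L p)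

signChanges-rotate-opposite : ∀ s L → signChanges (s ∷ L) ≤ 1 →
                              signChanges (L ++ [ opposite s ]) ≤ 1
signChanges-rotate-opposite _ []      _       = z≤n
signChanges-rotate-opposite + (+ ∷ L) p       = signChanges-snoc-opposite-head + L p
signChanges-rotate-opposite - (- ∷ L) p       = signChanges-snoc-opposite-head - L p
signChanges-rotate-opposite + (- ∷ L) (s≤s p) = m≤n⇒m≤1+n (signChanges-snoc-head - L p)
signChanges-rotate-opposite - (+ ∷ L) (s≤s p) = m≤n⇒m≤1+n (signChanges-snoc-head + L p)

signChanges-rotate : ∀ s L → signChanges (s ∷ L) ≤ 1 →
                     signChanges (map opposite L ++ [ s ]) ≤ 1
signChanges-rotate s L p = subst (_≤ 1) (sym changes-eq) (signChanges-rotate-opposite s L p)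
  where
  changes-eq : signChanges (map opposite L ++ [ s ]) ≡ signChanges (L ++ [ opposite s ])
  changes-eq = begin
    signChanges (map opposite L ++ [ s ])
      ≡⟨ cong (λ t → signChanges (map opposite L ++ [ t ])) (sym (opposite-involutive s)) ⟩
    signChanges (map opposite L ++ [ opposite (opposite s) ])
      ≡⟨ cong signChanges (sym (map-++ opposite L _)) ⟩
    signChanges (map opposite (L ++ [ opposite s ]))
      ≡⟨ signChanges-map-opposite (L ++ [ opposite s ]) ⟩
    signChanges (L ++ [ opposite s ]) ∎
    where open ≡-Reasoning

filter-∈?-map-suc : ∀ {n} b (X : Subset n) (xs : List (Fin n)) →
                    filter (_∈? (b ∷ X)) (map suc xs) ≡ map suc (filter (_∈? X) xs)
filter-∈?-map-suc b X []       = refl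
filter-∈?-map-suc b X (x ∷ xs) with does (x ∈? X)
... | true  = cong (suc x ∷_) (filter-∈?-map-suc b X xs)
... | false = filter-∈?-map-suc b X xs

elements-∷-tail : ∀ {n} b (X : Subset n) →
                  filter (_∈? (b ∷ X)) (List.tabulate suc) ≡ map suc (elements X)
elements-∷-tail b X =
  trans (cong (filter (_∈? (b ∷ X))) (sym (map-tabulate id suc)))
        (filter-∈?-map-suc b X (allFin _))

deletionSequence-true : ∀ {n} (σ : SignMap (suc n)) (X : Subset n) →
  deletionSequence σ (true ∷ X) ≡ σ (false ∷ X) ∷ deletionSequence (σ ∘ (true ∷_)) X
deletionSequence-true σ X = cong₂ _∷_
  (cong (σ ∘ (false ∷_)) (p─⊥≡p X))
  (trans (cong (map (λ x → σ ((true ∷ X) Subset.- x))) (elements-∷-tail true X))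
         (sym (map-∘ (elements X))))

deletionSequence-false : ∀ {n} (σ : SignMap (suc n)) (X : Subset n) →
  deletionSequence σ (false ∷ X) ≡ deletionSequence (σ ∘ (false ∷_)) X
deletionSequence-false σ X =
  trans (cong (map (λ x → σ ((false ∷ X) Subset.- x))) (elements-∷-tail false X))
        (sym (map-∘ (elements X)))

deletionSequence-∷ʳ-true : ∀ {n} (σ : SignMap (suc n)) (Y : Subset n) →
  deletionSequence σ (Y ∷ʳ true) ≡
  deletionSequence (λ Z → σ (Z ∷ʳ true)) Y ++ [ σ (Y ∷ʳ false) ]
deletionSequence-∷ʳ-true σ []      = deletionSequence-true σ []
deletionSequence-∷ʳ-true σ (true ∷ Y) = begin
  deletionSequence σ (true ∷ (Y ∷ʳ true))
    ≡⟨ deletionSequence-true σ (Y ∷ʳ true) ⟩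
  σ (false ∷ (Y ∷ʳ true)) ∷ deletionSequence (σ ∘ (true ∷_)) (Y ∷ʳ true)
    ≡⟨ cong (σ (false ∷ (Y ∷ʳ true)) ∷_) (deletionSequence-∷ʳ-true (σ ∘ (true ∷_)) Y) ⟩
  σ (false ∷ (Y ∷ʳ true)) ∷ deletionSequence (λ Z → σ (true ∷ (Z ∷ʳ true))) Y
                        ++ [ σ (true ∷ (Y ∷ʳ false)) ]
    ≡⟨ cong (_++ [ σ (true ∷ (Y ∷ʳ false)) ])
            (sym (deletionSequence-true (λ Z → σ (Z ∷ʳ true)) Y)) ⟩
  deletionSequence (λ Z → σ (Z ∷ʳ true)) (true ∷ Y) ++ [ σ (true ∷ (Y ∷ʳ false)) ] ∎
  where open ≡-Reasoning
deletionSequence-∷ʳ-true σ (false ∷ Y) = begin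
  deletionSequence σ (false ∷ (Y ∷ʳ true))
    ≡⟨ deletionSequence-false σ (Y ∷ʳ true) ⟩
  deletionSequence (σ ∘ (false ∷_)) (Y ∷ʳ true)
    ≡⟨ deletionSequence-∷ʳ-true (σ ∘ (false ∷_)) Y ⟩
  deletionSequence (λ Z → σ (false ∷ (Z ∷ʳ true))) Y ++ [ σ (false ∷ (Y ∷ʳ false)) ]
    ≡⟨ cong (_++ [ σ (false ∷ (Y ∷ʳ false)) ])
            (sym (deletionSequence-false (λ Z → σ (Z ∷ʳ true)) Y)) ⟩
  deletionSequence (λ Z → σ (Z ∷ʳ true)) (false ∷ Y) ++ [ σ (false ∷ (Y ∷ʳ false)) ] ∎
  where open ≡-Reasoning

deletionSequence-∷ʳ-false : ∀ {n} (σ : SignMap (suc n)) (Y : Subset n) →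
  deletionSequence σ (Y ∷ʳ false) ≡ deletionSequence (λ Z → σ (Z ∷ʳ false)) Y
deletionSequence-∷ʳ-false σ []      = deletionSequence-false σ []
deletionSequence-∷ʳ-false σ (true ∷ Y) = begin
  deletionSequence σ (true ∷ (Y ∷ʳ false))
    ≡⟨ deletionSequence-true σ (Y ∷ʳ false) ⟩
  σ (false ∷ (Y ∷ʳ false)) ∷ deletionSequence (σ ∘ (true ∷_)) (Y ∷ʳ false)
    ≡⟨ cong (σ (false ∷ (Y ∷ʳ false)) ∷_) (deletionSequence-∷ʳ-false (σ ∘ (true ∷_)) Y) ⟩
  σ (false ∷ (Y ∷ʳ false)) ∷ deletionSequence (λ Z → σ (true ∷ (Z ∷ʳ false))) Y
    ≡⟨ sym (deletionSequence-true (λ Z → σ (Z ∷ʳ false)) Y) ⟩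
  deletionSequence (λ Z → σ (Z ∷ʳ false)) (true ∷ Y) ∎
  where open ≡-Reasoning
deletionSequence-∷ʳ-false σ (false ∷ Y) = begin
  deletionSequence σ (false ∷ (Y ∷ʳ false))
    ≡⟨ deletionSequence-false σ (Y ∷ʳ false) ⟩
  deletionSequence (σ ∘ (false ∷_)) (Y ∷ʳ false)
    ≡⟨ deletionSequence-∷ʳ-false (σ ∘ (false ∷_)) Y ⟩
  deletionSequence (λ Z → σ (false ∷ (Z ∷ʳ false))) Y
    ≡⟨ sym (deletionSequence-false (λ Z → σ (Z ∷ʳ false)) Y) ⟩
  deletionSequence (λ Z → σ (Z ∷ʳ false)) (false ∷ Y) ∎
  where open ≡-Reasoning

lookup-∷ʳ-fromℕ : ∀ {A : Set} {n} (xs : Vec A n) x → lookup (xs ∷ʳ x) (fromℕ n) ≡ x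
lookup-∷ʳ-fromℕ []       x = refl
lookup-∷ʳ-fromℕ (_ ∷ xs) x = lookup-∷ʳ-fromℕ xs x

lookup-∷ʳ-inject₁ : ∀ {A : Set} {n} (xs : Vec A n) x i →
                    lookup (xs ∷ʳ x) (inject₁ i) ≡ lookup xs i
lookup-∷ʳ-inject₁ (_ ∷ xs) x zero    = refl
lookup-∷ʳ-inject₁ (_ ∷ xs) x (suc i) = lookup-∷ʳ-inject₁ xs x i

lookup-unrotElem : ∀ {A : Set} {n} x (xs : Vec A n) i →
                   lookup (x ∷ xs) (unrotElem i) ≡ lookup (xs ∷ʳ x) i
lookup-unrotElem x []       zero = refl
lookup-unrotElem x (_ ∷ xs) zero = refl
lookup-unrotElem {n = suc n} x (_ ∷ xs) (suc i)
  with unrotElem {suc n} i | lookup-unrotElem x xs i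
... | zero  | eq = eq
... | suc _ | eq = eq

shiftSet-∷ʳ : ∀ {n} (Y : Subset n) b → shiftSet (Y ∷ʳ b) ≡ b ∷ Y
shiftSet-∷ʳ Y b = trans (tabulate-cong lookup-rotElem) (tabulate∘lookup (b ∷ Y))
  where
  lookup-rotElem : ∀ i → lookup (Y ∷ʳ b) (rotElem i) ≡ lookup (b ∷ Y) i
  lookup-rotElem zero    = lookup-∷ʳ-fromℕ Y b
  lookup-rotElem (suc i) = lookup-∷ʳ-inject₁ Y b i

rotSet-∷ : ∀ {n} b (Y : Subset n) → rotSet (b ∷ Y) ≡ Y ∷ʳ b
rotSet-∷ b Y = trans (tabulate-cong (lookup-unrotElem b Y)) (tabulate∘lookup (Y ∷ʳ b))

rotSet-shiftSet : ∀ {n} (X : Subset n) → rotSet (shiftSet X) ≡ X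
rotSet-shiftSet {zero}  [] = refl
rotSet-shiftSet {suc n} X  with initLast X
... | Y , b , refl = trans (cong rotSet (shiftSet-∷ʳ Y b)) (rotSet-∷ b Y)

shiftSet-rotSet : ∀ {n} (F : Subset n) → shiftSet (rotSet F) ≡ F
shiftSet-rotSet []      = refl
shiftSet-rotSet (b ∷ Y) = trans (cong shiftSet (rotSet-∷ b Y)) (shiftSet-∷ʳ Y b)

∣∷ʳ∣ : ∀ {n} (Y : Subset n) b → ∣ Y ∷ʳ b ∣ ≡ ∣ b ∷ Y ∣
∣∷ʳ∣ []          b     = refl
∣∷ʳ∣ (true ∷ Y)  true  = cong suc (∣∷ʳ∣ Y true)
∣∷ʳ∣ (true ∷ Y)  false = cong suc (∣∷ʳ∣ Y false)
∣∷ʳ∣ (false ∷ Y) b     = ∣∷ʳ∣ Y b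

∣rotSet∣ : ∀ {n} (F : Subset n) → ∣ rotSet F ∣ ≡ ∣ F ∣
∣rotSet∣ []      = refl
∣rotSet∣ (b ∷ Y) = trans (cong ∣_∣ (rotSet-∷ b Y)) (∣∷ʳ∣ Y b)

flipIf : Bool → Sign → Sign
flipIf b s = if b then opposite s else s

flipIf-involutive : ∀ b s → flipIf b (flipIf b s) ≡ s
flipIf-involutive true  s = opposite-involutive s
flipIf-involutive false s = refl

rotSig-∷ʳ : ∀ {n} (σ : SignMap (suc n)) (Z : Subset n) b →
            rotSig σ (Z ∷ʳ b) ≡ flipIf b (σ (b ∷ Z))
rotSig-∷ʳ σ Z b = cong₂ flipIf (lookup-∷ʳ-fromℕ Z b) (cong σ (shiftSet-∷ʳ Z b))

deletionSequence-rotSig-∷ʳ-false : ∀ {n} (σ : SignMap (suc n)) (Y : Subset n) →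
  deletionSequence (rotSig σ) (Y ∷ʳ false) ≡ deletionSequence σ (false ∷ Y)
deletionSequence-rotSig-∷ʳ-false σ Y = begin
  deletionSequence (rotSig σ) (Y ∷ʳ false)
    ≡⟨ deletionSequence-∷ʳ-false (rotSig σ) Y ⟩
  deletionSequence (λ Z → rotSig σ (Z ∷ʳ false)) Y
    ≡⟨ map-cong (λ x → rotSig-∷ʳ σ (Y Subset.- x) false) (elements Y) ⟩
  deletionSequence (σ ∘ (false ∷_)) Y
    ≡⟨ sym (deletionSequence-false σ Y) ⟩
  deletionSequence σ (false ∷ Y) ∎
  where open ≡-Reasoning

deletionSequence-rotSig-∷ʳ-true : ∀ {n} (σ : SignMap (suc n)) (Y : Subset n) →
  deletionSequence (rotSig σ) (Y ∷ʳ true) ≡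
  map opposite (deletionSequence (σ ∘ (true ∷_)) Y) ++ [ σ (false ∷ Y) ]
deletionSequence-rotSig-∷ʳ-true σ Y = begin
  deletionSequence (rotSig σ) (Y ∷ʳ true)
    ≡⟨ deletionSequence-∷ʳ-true (rotSig σ) Y ⟩
  deletionSequence (λ Z → rotSig σ (Z ∷ʳ true)) Y ++ [ rotSig σ (Y ∷ʳ false) ]
    ≡⟨ cong₂ (λ L s → L ++ [ s ])
             (map-cong (λ x → rotSig-∷ʳ σ (Y Subset.- x) true) (elements Y))
             (rotSig-∷ʳ σ Y false) ⟩
  deletionSequence (opposite ∘ σ ∘ (true ∷_)) Y ++ [ σ (false ∷ Y) ]
    ≡⟨ cong (_++ [ σ (false ∷ Y) ]) (map-∘ (elements Y)) ⟩
  map opposite (deletionSequence (σ ∘ (true ∷_)) Y) ++ [ σ (false ∷ Y) ] ∎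
  where open ≡-Reasoning

rotSig-isSignotope : ∀ r {n} (σ : SignMap n) → IsSignotope r σ → IsSignotope r (rotSig σ)
rotSig-isSignotope r {zero}  σ _     [] ()
rotSig-isSignotope r {suc n} σ σ-sig X ∣X∣≡1+r with initLast X
... | Y , false , refl =
  subst (λ L → signChanges L ≤ 1) (sym (deletionSequence-rotSig-∷ʳ-false σ Y))
        (σ-sig (false ∷ Y) (trans (sym (∣∷ʳ∣ Y false)) ∣X∣≡1+r))
... | Y , true , refl =
  subst (λ L → signChanges L ≤ 1) (sym (deletionSequence-rotSig-∷ʳ-true σ Y))
        (signChanges-rotate (σ (false ∷ Y)) (deletionSequence (σ ∘ (true ∷_)) Y)
          (subst (λ L → signChanges L ≤ 1) (deletionSequence-true σ Y)
                 (σ-sig (true ∷ Y) (trans (sym (∣∷ʳ∣ Y true)) ∣X∣≡1+r))))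

IsSignotope-resp-≗ : ∀ r {n} {σ τ : SignMap n} → σ ≗ τ → IsSignotope r σ → IsSignotope r τ
IsSignotope-resp-≗ r σ≗τ σ-sig X ∣X∣≡1+r =
  subst (λ L → signChanges L ≤ 1) (map-cong (λ x → σ≗τ (X Subset.- x)) (elements X))
        (σ-sig X ∣X∣≡1+r)

setAt-same : ∀ {n} (σ : SignMap n) F s → setAt σ F s F ≡ s
setAt-same σ F s with ≡-dec BoolP._≟_ F F
... | yes _   = refl
... | no F≢F = ⊥-elim (F≢F refl)

setAt-other : ∀ {n} (σ : SignMap n) F s X → X ≢ F → setAt σ F s X ≡ σ X
setAt-other σ F s X X≢F with ≡-dec BoolP._≟_ X F
... | yes X≡F = ⊥-elim (X≢F X≡F)
... | no _    = refl

rotSig-setAt : ∀ {n} (σ : SignMap n) F s →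
  rotSig (setAt σ F (flipIf (containsMax (rotSet F)) s)) ≗ setAt (rotSig σ) (rotSet F) s
rotSig-setAt σ F s X with ≡-dec BoolP._≟_ X (rotSet F)
... | yes refl = begin
  flipIf c (setAt σ F (flipIf c s) (shiftSet (rotSet F)))
    ≡⟨ cong (flipIf c ∘ setAt σ F (flipIf c s)) (shiftSet-rotSet F) ⟩
  flipIf c (setAt σ F (flipIf c s) F)
    ≡⟨ cong (flipIf c) (setAt-same σ F (flipIf c s)) ⟩
  flipIf c (flipIf c s)
    ≡⟨ flipIf-involutive c s ⟩
  s ∎
  where
  open ≡-Reasoning
  c : Bool
  c = containsMax (rotSet F)
... | no X≢rotF = cong (flipIf (containsMax X)) (setAt-other σ F _ (shiftSet X) shiftX≢F)
  where
  shiftX≢F : shiftSet X ≢ F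
  shiftX≢F eq = X≢rotF (trans (sym (rotSet-shiftSet X)) (cong rotSet eq))

lemma7 : (r n : ℕ) → 1 ≤ r → (σ : SignMap n) → IsSignotope r σ →
         (F : Subset n) → IsFliple r σ F → IsFliple r (rotSig σ) (rotSet F)
lemma7 r n _ σ _ F (∣F∣≡r , σ⁺-sig , σ⁻-sig) =
  trans (∣rotSet∣ F) ∣F∣≡r , rotated-flip + , rotated-flip -
  where
  flip : ∀ t → IsSignotope r (setAt σ F t)
  flip + = σ⁺-sig
  flip - = σ⁻-sig
  rotated-flip : ∀ s → IsSignotope r (setAt (rotSig σ) (rotSet F) s)
  rotated-flip s = IsSignotope-resp-≗ r (rotSig-setAt σ F s)
    (rotSig-isSignotope r (setAt σ F t) (flip t))
    where
    t : Sign
    t = flipIf (containsMax (rotSet F)) s
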